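{- For every $n\ge1$ and every complex number $z$, $$\mathsf E_n z^{r_n}=\frac{2^n}{|\mathcal S_n|}\prod_{k=1}^n(z+2k-1).$$
   Context: A staircase tableau of size $n$ is a Young diagram of shape $(n,n-1,\dots,2,1)$ (English convention: rows left-justified, the $i$-th row from the top has $n-i+1$ boxes) whose boxes are filled according to the rules: each box is either empty or contains one of the letters $\alpha,\beta,\gamma,\delta$; no box on the diagonal (the rightmost box of each row) is empty; all boxes in the same row and to the left of a $\beta$ or a $\delta$ are empty; all boxes in the same column and above an $\alpha$ or a $\gamma$ are empty. $\mathcal S_n$ is the set of staircase tableaux of size $n$, equipped with the uniform probability measure $\mathsf P_n$; $\mathsf E_n$ denotes expectation with respect to $\mathsf P_n$. A row is called an $\alpha/\gamma$ row if its leftmost nonempty box contains $\alpha$ or $\gamma$; $r_n(S)$ is the number of $\alpha/\gamma$ rows of $S\in\mathcal S_n$. -}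

module Defs where

import Data.Nat as ℕ
open import Data.Nat using (ℕ; zero; suc; _∸_; _≡ᵇ_)
open import Data.Bool using (Bool; true; false; _∧_; _∨_; not; if_then_else_)
open import Data.Maybe using (Maybe; just; nothing)
open import Data.List using (List; []; _∷_; map; filter; concatMap; upTo; foldr; length)
open import Relation.Nullary.Decidable using (Dec; yes; no)
open import Relation.Binary.PropositionalEquality using (_≡_; refl)
open import Data.Bool using (T)
open import Data.Bool.Properties using (T?)
open import Level using (Level)
open import Algebra.Bundles using (CommutativeRing)

data Letter : Set where
  α β γ δ : Letter

Cell : Set
Cell = Maybe Letter

allCells : List Cell
allCells = nothing ∷ just α ∷ just β ∷ just γ ∷ just δ ∷ []

-- A filling of a Young diagram: list of rows from top to bottom,
-- each row a list of boxes from left to right (0-indexed).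
Filling : Set
Filling = List (List Cell)

rowsOfLength : ℕ → List (List Cell)
rowsOfLength zero = [] ∷ []
rowsOfLength (suc k) = concatMap (λ c → map (c ∷_) (rowsOfLength k)) allCells

staircaseFillings : ℕ → List Filling
staircaseFillings zero = [] ∷ []
staircaseFillings (suc n) =
  concatMap (λ r → map (r ∷_) (staircaseFillings n)) (rowsOfLength (suc n))

at : {A : Set} → A → List A → ℕ → A
at d [] _ = d
at d (x ∷ xs) zero = x
at d (x ∷ xs) (suc i) = at d xs i

-- content of box in row i, column j (0-indexed, top-left = (0,0))
cell : Filling → ℕ → ℕ → Cell
cell S i j = at nothing (at [] S i) j

isEmpty : Cell → Bool
isEmpty nothing = true
isEmpty (just _) = false

isβδ : Cell → Bool
isβδ (just β) = true
isβδ (just δ) = true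
isβδ _ = false

isαγ : Cell → Bool
isαγ (just α) = true
isαγ (just γ) = true
isαγ _ = false

all : {A : Set} → (A → Bool) → List A → Bool
all p = foldr (λ x b → p x ∧ b) true

_⇒ᵇ_ : Bool → Bool → Bool
a ⇒ᵇ b = not a ∨ b

-- the rules for a staircase tableau of size n; row i (0 ≤ i < n) has
-- boxes in columns 0 ≤ j < n - i, its diagonal box is column n - 1 - i.
boxOK : ℕ → Filling → ℕ → ℕ → Bool
boxOK n S i j =
  ((j ≡ᵇ (n ∸ suc i)) ⇒ᵇ not (isEmpty (cell S i j)))
  ∧ (isβδ (cell S i j) ⇒ᵇ all (λ j' → isEmpty (cell S i j')) (upTo j))
  ∧ (isαγ (cell S i j) ⇒ᵇ all (λ i' → isEmpty (cell S i' j)) (upTo i))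

isStaircaseTableau : ℕ → Filling → Bool
isStaircaseTableau n S =
  all (λ i → all (λ j → boxOK n S i j) (upTo (n ∸ i))) (upTo n)

-- 𝒮_n : the (duplicate-free) list of all staircase tableaux of size n
𝒮 : ℕ → List Filling
𝒮 n = filter (λ S → T? (isStaircaseTableau n S)) (staircaseFillings n)

leftmost : List Cell → Cell
leftmost [] = nothing
leftmost (nothing ∷ xs) = leftmost xs
leftmost (just x ∷ xs) = just x

r : Filling → ℕ
r [] = 0
r (row ∷ S) = (if isαγ (leftmost row) then 1 else 0) ℕ.+ r S

module RingOps {c ℓ : Level} (R : CommutativeRing c ℓ) where
  open CommutativeRing R

  fromℕ : ℕ → Carrier
  fromℕ zero = 0#
  fromℕ (suc m) = 1# + fromℕ m

  pow : Carrier → ℕ → Carrier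
  pow x zero = 1#
  pow x (suc m) = x * pow x m

  sumR : List Carrier → Carrier
  sumR = foldr _+_ 0#

  prod1 : ℕ → (ℕ → Carrier) → Carrier
  prod1 zero f = 1#
  prod1 (suc m) f = prod1 m f * f (suc m)

-- Write T_n(z) for the sum of z^(r S) over all staircase tableaux S of size n.
-- Deleting the first column of a tableau of size n + 1 leaves a tableau of
-- size n, and a column may be put in front of a tableau exactly when its
-- bottom box is nonempty, no α/γ of it lies below a nonempty box, and it is
-- empty in every row containing a β/δ.  In a tableau a row is an α/γ row iff
-- it contains no β/δ.  Summing over the column from top to bottom is then a
-- two-state computation (state: are all boxes above still empty?): a row with
-- a β/δ admits only the empty box, while an α/γ row stays an α/γ row (weight
-- z) unless the new box is β/δ (weight 1), and the new box may be α/γ only in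
-- the initial state.  This gives T_(n+1)(z) = 2(z+1) T_n(z+2), and iterating
-- yields T_n(z) = 2^n (z+1)(z+3)...(z+2n-1).
module Submission where

open import Defs
import Data.Nat as ℕ
open import Data.Nat using (ℕ; _≤_; _∸_)
open import Data.List using (map)
open import Algebra.Bundles using (CommutativeRing)

open import Algebra.Bundles using (CommutativeMonoid)
open import Function using (_∘_)
open import Data.Nat using (zero; suc; _<_; _≡ᵇ_; s≤s; z≤n)
open import Data.Nat.Properties using (n∸n≡0; +-∸-assoc; m∸n≢0⇒n<m; n≮0; suc-injective; ≤-pred; +-suc)
open import Data.Bool using (Bool; true; false; _∧_; _∨_; not; if_then_else_)
open import Data.Bool.Properties
  using (T?; ∧-assoc; ∧-comm; ∧-identityʳ; ∧-idem; ∧-commutativeMonoid)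
open import Algebra.Properties.CommutativeSemigroup (CommutativeMonoid.commutativeSemigroup ∧-commutativeMonoid)
  using () renaming (interchange to ∧-interchange; x∙yz≈y∙xz to ∧-rotate)
open import Data.Maybe using (just; nothing)
open import Data.List using (List; []; _∷_; _++_; filter; concatMap; upTo; applyUpTo; length)
open import Data.List.Relation.Unary.All as All using (All; []; _∷_)
open import Data.List.Relation.Unary.All.Properties using (map⁺; concat⁺)
open import Data.Product using (Σ-syntax; _×_; _,_; proj₂)
open import Relation.Binary.PropositionalEquality
  using (_≡_; refl; cong; cong₂; sym; trans; subst; module ≡-Reasoning)

∧-≡-true : ∀ {a b} → a ∧ b ≡ true → a ≡ true × b ≡ true
∧-≡-true {true}  {true}  _  = refl , refl
∧-≡-true {true}  {false} ()
∧-≡-true {false}         ()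

∨-⇒ᵇ : ∀ a b x → ((a ∨ b) ⇒ᵇ x) ≡ (a ⇒ᵇ x) ∧ (b ⇒ᵇ x)
∨-⇒ᵇ true  true  x = sym (∧-idem x)
∨-⇒ᵇ true  false x = sym (∧-identityʳ x)
∨-⇒ᵇ false b     x = refl

⇒ᵇ-∧-split : ∀ d b e x a → d ∧ (b ⇒ᵇ (e ∧ x)) ∧ a ≡ (d ∧ (b ⇒ᵇ x) ∧ a) ∧ (b ⇒ᵇ e)
⇒ᵇ-∧-split false b     e x a = refl
⇒ᵇ-∧-split true  false e x a = sym (∧-identityʳ a)
⇒ᵇ-∧-split true  true  e x a = trans (∧-assoc e x a) (∧-comm e (x ∧ a))

⇒ᵇ-false : ∀ b → (b ⇒ᵇ false) ≡ true → true ≡ not b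
⇒ᵇ-false false _  = refl
⇒ᵇ-false true  ()

<∸⇒> : ∀ {i j n} → j < n ∸ i → i < n
<∸⇒> {i} {j} {n} j<n∸i = m∸n≢0⇒n<m (λ n∸i≡0 → n≮0 (subst (j <_) n∸i≡0 j<n∸i))

2[2+k]∸1 : ∀ k → 2 ℕ.* suc (suc k) ∸ 1 ≡ suc (suc (2 ℕ.* suc k ∸ 1))
2[2+k]∸1 k = cong suc (+-suc k (suc (k ℕ.+ 0)))

all< : ℕ → (ℕ → Bool) → Bool
all< zero    p = true
all< (suc m) p = p 0 ∧ all< m (p ∘ suc)

all<-cong : ∀ m {p q : ℕ → Bool} → (∀ {i} → i < m → p i ≡ q i) → all< m p ≡ all< m q
all<-cong zero    p≗q = refl
all<-cong (suc m) p≗q = cong₂ _∧_ (p≗q (s≤s z≤n)) (all<-cong m (λ i<m → p≗q (s≤s i<m)))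

all-applyUpTo : ∀ m p (f : ℕ → ℕ) → all p (applyUpTo f m) ≡ all< m (p ∘ f)
all-applyUpTo zero    p f = refl
all-applyUpTo (suc m) p f = cong (p (f 0) ∧_) (all-applyUpTo m p (f ∘ suc))

all-upTo : ∀ m p → all p (upTo m) ≡ all< m p
all-upTo m p = all-applyUpTo m p (λ i → i)

all<-∧ : ∀ m p q → all< m (λ i → p i ∧ q i) ≡ all< m p ∧ all< m q
all<-∧ zero    p q = refl
all<-∧ (suc m) p q =
  trans (cong ((p 0 ∧ q 0) ∧_) (all<-∧ m (p ∘ suc) (q ∘ suc))) (∧-interchange (p 0) (q 0) _ _)

all<-suc : ∀ m p → all< (suc m) p ≡ all< m p ∧ p m
all<-suc zero    p = ∧-identityʳ (p 0)
all<-suc (suc m) p = trans (cong (p 0 ∧_) (all<-suc m (p ∘ suc))) (sym (∧-assoc (p 0) _ _))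

-- Tableaux as grids

-- Read as a function of (row, column), removing the first column of a filling
-- becomes an index shift (consColumn below).
Grid : Set
Grid = ℕ → ℕ → Cell

gridBoxOK : ℕ → Grid → ℕ → ℕ → Bool
gridBoxOK n F i j =
  ((j ≡ᵇ (n ∸ suc i)) ⇒ᵇ not (isEmpty (F i j)))
  ∧ (isβδ (F i j) ⇒ᵇ all< j (λ j' → isEmpty (F i j')))
  ∧ (isαγ (F i j) ⇒ᵇ all< i (λ i' → isEmpty (F i' j)))

gridRowOK : ℕ → Grid → ℕ → Bool
gridRowOK n F i = all< (n ∸ i) (gridBoxOK n F i)

isStaircaseGrid : ℕ → Grid → Bool
isStaircaseGrid n F = all< n (gridRowOK n F)

isStaircaseTableau≡isStaircaseGrid : ∀ n S → isStaircaseTableau n S ≡ isStaircaseGrid n (cell S)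
isStaircaseTableau≡isStaircaseGrid n S =
  trans (all-upTo n _) (all<-cong n (λ {i} _ →
    trans (all-upTo (n ∸ i) _) (all<-cong (n ∸ i) (λ {j} _ → boxOK≡gridBoxOK i j))))
  where
  boxOK≡gridBoxOK : ∀ i j → boxOK n S i j ≡ gridBoxOK n (cell S) i j
  boxOK≡gridBoxOK i j =
    cong₂ (λ a b → ((j ≡ᵇ (n ∸ suc i)) ⇒ᵇ not (isEmpty (cell S i j)))
                   ∧ (isβδ (cell S i j) ⇒ᵇ a) ∧ (isαγ (cell S i j) ⇒ᵇ b))
          (all-upTo j _) (all-upTo i _)

isStaircaseGrid-cong : ∀ n {F G : Grid} → (∀ i j → F i j ≡ G i j) → isStaircaseGrid n F ≡ isStaircaseGrid n G
isStaircaseGrid-cong n {F} {G} F≗G = all<-cong n (λ {i} _ → all<-cong (n ∸ i) (λ {j} _ → box i j))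
  where
  box : ∀ i j → gridBoxOK n F i j ≡ gridBoxOK n G i j
  box i j rewrite F≗G i j =
    cong₂ (λ a b → ((j ≡ᵇ (n ∸ suc i)) ⇒ᵇ not (isEmpty (G i j)))
                   ∧ (isβδ (G i j) ⇒ᵇ a) ∧ (isαγ (G i j) ⇒ᵇ b))
          (all<-cong j (λ _ → cong isEmpty (F≗G i _))) (all<-cong i (λ _ → cong isEmpty (F≗G _ j)))

-- Removing the first column

prependColumn : List Cell → Filling → Filling
prependColumn []       []           = []
prependColumn []       (row ∷ rows) = (nothing ∷ row) ∷ prependColumn [] rows
prependColumn (c ∷ cs) []           = (c ∷ []) ∷ prependColumn cs []
prependColumn (c ∷ cs) (row ∷ rows) = (c ∷ row) ∷ prependColumn cs rows

consColumn : (ℕ → Cell) → Grid → Grid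
consColumn c F i zero    = c i
consColumn c F i (suc j) = F i j

cell-prependColumn-0 : ∀ col rows i → cell (prependColumn col rows) i 0 ≡ at nothing col i
cell-prependColumn-0 []       []           i       = refl
cell-prependColumn-0 []       (row ∷ rows) zero    = refl
cell-prependColumn-0 []       (row ∷ rows) (suc i) = cell-prependColumn-0 [] rows i
cell-prependColumn-0 (c ∷ cs) []           zero    = refl
cell-prependColumn-0 (c ∷ cs) []           (suc i) = cell-prependColumn-0 cs [] i
cell-prependColumn-0 (c ∷ cs) (row ∷ rows) zero    = refl
cell-prependColumn-0 (c ∷ cs) (row ∷ rows) (suc i) = cell-prependColumn-0 cs rows i

cell-prependColumn-suc : ∀ col rows i j → cell (prependColumn col rows) i (suc j) ≡ cell rows i j
cell-prependColumn-suc []       []           i       j = refl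
cell-prependColumn-suc []       (row ∷ rows) zero    j = refl
cell-prependColumn-suc []       (row ∷ rows) (suc i) j = cell-prependColumn-suc [] rows i j
cell-prependColumn-suc (c ∷ cs) []           zero    j = refl
cell-prependColumn-suc (c ∷ cs) []           (suc i) j = cell-prependColumn-suc cs [] i j
cell-prependColumn-suc (c ∷ cs) (row ∷ rows) zero    j = refl
cell-prependColumn-suc (c ∷ cs) (row ∷ rows) (suc i) j = cell-prependColumn-suc cs rows i j

cell-prependColumn : ∀ col rows i j →
  cell (prependColumn col rows) i j ≡ consColumn (at nothing col) (cell rows) i j
cell-prependColumn col rows i zero    = cell-prependColumn-0 col rows i
cell-prependColumn col rows i (suc j) = cell-prependColumn-suc col rows i j

-- `clear` says that all boxes above the column are empty (true for a genuine
-- first column; it is passed down when the column is read row by row).  With clear = true, columnBoxOK is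
-- definitionally the condition gridBoxOK on the box in column 0, which is why
-- it keeps the trivial conjunct for β/δ.
columnBoxOK : Bool → ℕ → (ℕ → Cell) → ℕ → Bool
columnBoxOK clear n c i =
  ((0 ≡ᵇ (n ∸ i)) ⇒ᵇ not (isEmpty (c i)))
  ∧ (isβδ (c i) ⇒ᵇ true)
  ∧ (isαγ (c i) ⇒ᵇ (clear ∧ all< i (λ i' → isEmpty (c i'))))

columnOK : Bool → ℕ → (ℕ → Cell) → Bool
columnOK clear n c = all< (suc n) (columnBoxOK clear n c)

compatibleRow : ℕ → (ℕ → Cell) → Grid → ℕ → Bool
compatibleRow n c F i = all< (n ∸ i) (λ j → isβδ (F i j) ⇒ᵇ isEmpty (c i))

compatible : ℕ → (ℕ → Cell) → Grid → Bool
compatible n c F = all< (suc n) (compatibleRow n c F)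

gridBoxOK-consColumn : ∀ n c F i j → i < n →
  gridBoxOK (suc n) (consColumn c F) i (suc j) ≡ gridBoxOK n F i j ∧ (isβδ (F i j) ⇒ᵇ isEmpty (c i))
gridBoxOK-consColumn n c F i j i<n rewrite +-∸-assoc 1 i<n =
  ⇒ᵇ-∧-split ((j ≡ᵇ (n ∸ suc i)) ⇒ᵇ not (isEmpty (F i j))) (isβδ (F i j)) (isEmpty (c i))
             (all< j (λ j' → isEmpty (F i j'))) (isαγ (F i j) ⇒ᵇ all< i (λ i' → isEmpty (F i' j)))

gridRowOK-consColumn : ∀ n c F i → i ≤ n →
  gridRowOK (suc n) (consColumn c F) i
  ≡ columnBoxOK true n c i ∧ all< (n ∸ i) (λ j → gridBoxOK n F i j ∧ (isβδ (F i j) ⇒ᵇ isEmpty (c i)))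
gridRowOK-consColumn n c F i i≤n rewrite +-∸-assoc 1 i≤n =
  cong (columnBoxOK true n c i ∧_) (all<-cong (n ∸ i) (λ j< → gridBoxOK-consColumn n c F i _ (<∸⇒> j<)))

isStaircaseGrid-consColumn : ∀ n c F →
  isStaircaseGrid (suc n) (consColumn c F) ≡ isStaircaseGrid n F ∧ (columnOK true n c ∧ compatible n c F)
isStaircaseGrid-consColumn n c F = begin
  isStaircaseGrid (suc n) (consColumn c F)
    ≡⟨ all<-cong (suc n) (λ i<1+n → gridRowOK-consColumn n c F _ (≤-pred i<1+n)) ⟩
  all< (suc n) (λ i → columnBoxOK true n c i ∧ all< (n ∸ i) (λ j → gridBoxOK n F i j ∧ compat i j))
    ≡⟨ all<-∧ (suc n) (columnBoxOK true n c) (λ i → all< (n ∸ i) (λ j → gridBoxOK n F i j ∧ compat i j)) ⟩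
  columnOK true n c ∧ all< (suc n) (λ i → all< (n ∸ i) (λ j → gridBoxOK n F i j ∧ compat i j))
    ≡⟨ cong (columnOK true n c ∧_) (trans
         (all<-cong (suc n) (λ {i} _ → all<-∧ (n ∸ i) (gridBoxOK n F i) (compat i)))
         (all<-∧ (suc n) (gridRowOK n F) (compatibleRow n c F))) ⟩
  columnOK true n c ∧ (all< (suc n) (gridRowOK n F) ∧ compatible n c F)
    ≡⟨ cong (λ b → columnOK true n c ∧ (b ∧ compatible n c F)) lastRowVacuous ⟩
  columnOK true n c ∧ (isStaircaseGrid n F ∧ compatible n c F)
    ≡⟨ ∧-rotate (columnOK true n c) (isStaircaseGrid n F) (compatible n c F) ⟩
  isStaircaseGrid n F ∧ (columnOK true n c ∧ compatible n c F) ∎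
  where
  open ≡-Reasoning

  compat : ℕ → ℕ → Bool
  compat i j = isβδ (F i j) ⇒ᵇ isEmpty (c i)

  lastRowVacuous : all< (suc n) (gridRowOK n F) ≡ isStaircaseGrid n F
  lastRowVacuous = trans (all<-suc n (gridRowOK n F))
    (trans (cong (λ k → isStaircaseGrid n F ∧ all< k (gridBoxOK n F n)) (n∸n≡0 n))
           (∧-identityʳ (isStaircaseGrid n F)))

columnFits : Bool → ℕ → List Cell → Filling → Bool
columnFits clear n col rows = columnOK clear n (at nothing col) ∧ compatible n (at nothing col) (cell rows)

isStaircaseGrid-prependColumn : ∀ n col rows →
  isStaircaseGrid (suc n) (cell (prependColumn col rows)) ≡ isStaircaseGrid n (cell rows) ∧ columnFits true n col rows
isStaircaseGrid-prependColumn n col rows =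
  trans (isStaircaseGrid-cong (suc n) (cell-prependColumn col rows))
        (isStaircaseGrid-consColumn n (at nothing col) (cell rows))

hasβδ : List Cell → Bool
hasβδ []       = false
hasβδ (c ∷ cs) = isβδ c ∨ hasβδ cs

all<-βδ⇒ᵇ : ∀ row {m} x → length row ≡ m →
  all< m (λ j → isβδ (at nothing row j) ⇒ᵇ x) ≡ (hasβδ row ⇒ᵇ x)
all<-βδ⇒ᵇ []      x refl = refl
all<-βδ⇒ᵇ (c ∷ row) x refl =
  trans (cong ((isβδ c ⇒ᵇ x) ∧_) (all<-βδ⇒ᵇ row x refl)) (sym (∨-⇒ᵇ (isβδ c) (hasβδ row) x))

topBoxOK : ∀ clear c → (isβδ c ⇒ᵇ true) ∧ (isαγ c ⇒ᵇ (clear ∧ true)) ≡ (isαγ c ⇒ᵇ clear)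
topBoxOK clear nothing  = refl
topBoxOK clear (just α) = ∧-identityʳ clear
topBoxOK clear (just β) = refl
topBoxOK clear (just γ) = ∧-identityʳ clear
topBoxOK clear (just δ) = refl

columnOK-tail : ∀ clear n c col →
  all< (suc n) (columnBoxOK clear (suc n) (at nothing (c ∷ col)) ∘ suc)
  ≡ columnOK (clear ∧ isEmpty c) n (at nothing col)
columnOK-tail true  n c col = refl
columnOK-tail false n c col = refl

columnFits-∷ : ∀ clear n c col row rows → length row ≡ suc n →
  columnFits clear (suc n) (c ∷ col) (row ∷ rows)
  ≡ ((isαγ c ⇒ᵇ clear) ∧ (hasβδ row ⇒ᵇ isEmpty c)) ∧ columnFits (clear ∧ isEmpty c) n col rows
columnFits-∷ clear n c col row rows lr =
  trans (cong₂ (λ a b → a ∧ (b ∧ compatible n (at nothing col) (cell rows)))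
               (cong₂ _∧_ (topBoxOK clear c) (columnOK-tail clear n c col))
               (all<-βδ⇒ᵇ row (isEmpty c) lr))
        (∧-interchange (isαγ c ⇒ᵇ clear) _ _ _)

-- Shapes and α/γ rows

data StaircaseShape : ℕ → Filling → Set where
  []  : StaircaseShape 0 []
  _∷_ : ∀ {n row rows} → length row ≡ suc n → StaircaseShape n rows → StaircaseShape (suc n) (row ∷ rows)

split-firstColumn : ∀ {n S} → StaircaseShape (suc n) S →
  Σ[ c ∈ Cell ] Σ[ col ∈ List Cell ] Σ[ rows ∈ Filling ]
    length col ≡ n × StaircaseShape n rows × S ≡ prependColumn (c ∷ col) rows
split-firstColumn {zero}  (_∷_ {row = c ∷ []} refl []) = c , [] , [] , refl , [] , refl
split-firstColumn {suc n} (_∷_ {row = c ∷ row} lr sh) with split-firstColumn sh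
... | c′ , col , rows , lc , shr , refl =
  c , c′ ∷ col , row ∷ rows , cong suc lc , suc-injective lr ∷ shr , refl

rowsOfLength-length : ∀ k → All (λ row → length row ≡ k) (rowsOfLength k)
rowsOfLength-length zero    = refl ∷ []
rowsOfLength-length (suc k) =
  concat⁺ (map⁺ (All.universal prefixed allCells))
  where
  prefixed : ∀ c → All (λ row → length row ≡ suc k) (map (c ∷_) (rowsOfLength k))
  prefixed c = map⁺ (All.map (cong suc) (rowsOfLength-length k))

staircaseFillings-shape : ∀ n → All (StaircaseShape n) (staircaseFillings n)
staircaseFillings-shape zero    = [] ∷ []
staircaseFillings-shape (suc n) =
  concat⁺ (map⁺ (All.map (λ lr → map⁺ (All.map (lr ∷_) (staircaseFillings-shape n)))
                         (rowsOfLength-length (suc n))))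

-- In a tableau the leftmost nonempty box of a row is its first β/δ if there is
-- one (everything left of a β/δ is empty), and some box exists because the
-- diagonal is filled; so r counts exactly the rows without β/δ.
αγ⇔¬βδ : List Cell → Set
αγ⇔¬βδ row = isαγ (leftmost row) ≡ not (hasβδ row)

αγ⇔¬βδ-∷ : ∀ c row → αγ⇔¬βδ row → (hasβδ row ⇒ᵇ isEmpty c) ≡ true → αγ⇔¬βδ (c ∷ row)
αγ⇔¬βδ-∷ nothing  row g _ = g
αγ⇔¬βδ-∷ (just α) row g q = ⇒ᵇ-false (hasβδ row) q
αγ⇔¬βδ-∷ (just β) row g _ = refl
αγ⇔¬βδ-∷ (just γ) row g q = ⇒ᵇ-false (hasβδ row) q
αγ⇔¬βδ-∷ (just δ) row g _ = refl

prependColumn-αγ⇔¬βδ : ∀ n clear c col rows → StaircaseShape n rows → length col ≡ n →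
  All αγ⇔¬βδ rows → columnFits clear n (c ∷ col) rows ≡ true →
  All αγ⇔¬βδ (prependColumn (c ∷ col) rows)
prependColumn-αγ⇔¬βδ zero    clear nothing  [] [] [] refl [] ()
prependColumn-αγ⇔¬βδ zero    clear (just α) [] [] [] refl [] _ = refl ∷ []
prependColumn-αγ⇔¬βδ zero    clear (just β) [] [] [] refl [] _ = refl ∷ []
prependColumn-αγ⇔¬βδ zero    clear (just γ) [] [] [] refl [] _ = refl ∷ []
prependColumn-αγ⇔¬βδ zero    clear (just δ) [] [] [] refl [] _ = refl ∷ []
prependColumn-αγ⇔¬βδ (suc n) clear c (c′ ∷ col) (row ∷ rows) (lr ∷ sh) lc (g ∷ gs) fits
  with ∧-≡-true (trans (sym (columnFits-∷ clear n c (c′ ∷ col) row rows lr)) fits)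
... | headFits , tailFits =
  αγ⇔¬βδ-∷ c row g (proj₂ (∧-≡-true {isαγ c ⇒ᵇ clear} headFits))
  ∷ prependColumn-αγ⇔¬βδ n (clear ∧ isEmpty c) c′ col rows sh (suc-injective lc) gs tailFits

isStaircaseGrid⇒αγ⇔¬βδ : ∀ n S → StaircaseShape n S →
  isStaircaseGrid n (cell S) ≡ true → All αγ⇔¬βδ S
isStaircaseGrid⇒αγ⇔¬βδ zero    [] [] _ = []
isStaircaseGrid⇒αγ⇔¬βδ (suc n) S sh valid with split-firstColumn sh
... | c , col , rows , lc , shr , refl
  with ∧-≡-true (trans (sym (isStaircaseGrid-prependColumn n (c ∷ col) rows)) valid)
... | validRows , fits =
  prependColumn-αγ⇔¬βδ n true c col rows shr lc (isStaircaseGrid⇒αγ⇔¬βδ n rows shr validRows) fits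

isαγRow-∷ : Cell → Bool → Bool
isαγRow-∷ nothing  αγ = αγ
isαγRow-∷ (just x) _  = isαγ (just x)

isαγ-leftmost-∷ : ∀ c row → isαγ (leftmost (c ∷ row)) ≡ isαγRow-∷ c (isαγ (leftmost row))
isαγ-leftmost-∷ nothing  row = refl
isαγ-leftmost-∷ (just x) row = refl

-- The generating polynomial of r

module GeneratingFunction {c ℓ} (R : CommutativeRing c ℓ) where
  open CommutativeRing R renaming (refl to ≈-refl; sym to ≈-sym; trans to ≈-trans)
  open RingOps R
  open import Algebra.Properties.CommutativeSemigroup +-commutativeSemigroup
    using () renaming (interchange to +-interchange)
  open import Algebra.Properties.CommutativeSemigroup *-commutativeSemigroup
    using () renaming (x∙yz≈y∙xz to x*[y*z]≈y*[x*z])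
  open import Algebra.Solver.Ring.NaturalCoefficients.Default commutativeSemiring
  open import Relation.Binary.Reasoning.Setoid setoid

  ∑ : {A : Set} → List A → (A → Carrier) → Carrier
  ∑ xs f = sumR (map f xs)

  syntax ∑ xs (λ x → e) = ∑[ x ∈ xs ] e

  infixl 5 _when_
  _when_ : Carrier → Bool → Carrier
  x when b = if b then x else 0#

  ∑-cong : ∀ {A : Set} (xs : List A) {f g : A → Carrier} → (∀ x → f x ≈ g x) → ∑ xs f ≈ ∑ xs g
  ∑-cong []       f≈g = ≈-refl
  ∑-cong (x ∷ xs) f≈g = +-cong (f≈g x) (∑-cong xs f≈g)

  ∑-cong-All : ∀ {A : Set} {P : A → Set} {xs : List A} {f g : A → Carrier} →
    All P xs → (∀ {x} → P x → f x ≈ g x) → ∑ xs f ≈ ∑ xs g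
  ∑-cong-All []         f≈g = ≈-refl
  ∑-cong-All (px ∷ pxs) f≈g = +-cong (f≈g px) (∑-cong-All pxs f≈g)

  ∑-++ : ∀ {A : Set} (xs ys : List A) f → ∑ (xs ++ ys) f ≈ ∑ xs f + ∑ ys f
  ∑-++ []       ys f = ≈-sym (+-identityˡ _)
  ∑-++ (x ∷ xs) ys f = ≈-trans (+-congˡ (∑-++ xs ys f)) (≈-sym (+-assoc _ _ _))

  ∑-map : ∀ {A B : Set} (h : A → B) (xs : List A) f → ∑ (map h xs) f ≈ ∑ xs (f ∘ h)
  ∑-map h []       f = ≈-refl
  ∑-map h (x ∷ xs) f = +-congˡ (∑-map h xs f)

  ∑-concatMap : ∀ {A B : Set} (g : A → List B) (xs : List A) f →
    ∑ (concatMap g xs) f ≈ ∑[ x ∈ xs ] ∑ (g x) f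
  ∑-concatMap g []       f = ≈-refl
  ∑-concatMap g (x ∷ xs) f = ≈-trans (∑-++ (g x) (concatMap g xs) f) (+-congˡ (∑-concatMap g xs f))

  ∑-pairs : ∀ {A B C : Set} (g : A → B → C) (xs : List A) (ys : List B) f →
    ∑ (concatMap (λ a → map (g a) ys) xs) f ≈ ∑[ a ∈ xs ] ∑[ b ∈ ys ] f (g a b)
  ∑-pairs g xs ys f = ≈-trans (∑-concatMap (λ a → map (g a) ys) xs f) (∑-cong xs (λ a → ∑-map (g a) ys f))

  ∑-0 : ∀ {A : Set} (xs : List A) → ∑[ x ∈ xs ] 0# ≈ 0#
  ∑-0 []       = ≈-refl
  ∑-0 (x ∷ xs) = ≈-trans (+-congˡ (∑-0 xs)) (+-identityˡ 0#)

  ∑-+ : ∀ {A : Set} (xs : List A) f g → ∑[ x ∈ xs ] (f x + g x) ≈ ∑ xs f + ∑ xs g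
  ∑-+ []       f g = ≈-sym (+-identityˡ 0#)
  ∑-+ (x ∷ xs) f g = ≈-trans (+-congˡ (∑-+ xs f g)) (+-interchange _ _ _ _)

  ∑-swap : ∀ {A B : Set} (xs : List A) (ys : List B) (f : A → B → Carrier) →
    ∑[ x ∈ xs ] ∑ ys (f x) ≈ ∑[ y ∈ ys ] ∑[ x ∈ xs ] f x y
  ∑-swap []       ys f = ≈-sym (∑-0 ys)
  ∑-swap (x ∷ xs) ys f =
    ≈-trans (+-congˡ (∑-swap xs ys f)) (≈-sym (∑-+ ys (f x) (λ y → ∑[ x′ ∈ xs ] f x′ y)))

  ∑-*ˡ : ∀ {A : Set} (xs : List A) a f → ∑[ x ∈ xs ] (a * f x) ≈ a * ∑ xs f
  ∑-*ˡ []       a f = ≈-sym (zeroʳ a)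
  ∑-*ˡ (x ∷ xs) a f = ≈-trans (+-congˡ (∑-*ˡ xs a f)) (≈-sym (distribˡ a _ _))

  ∑-*ˡ-when : ∀ {A : Set} (xs : List A) b a f → ∑[ x ∈ xs ] (a * f x when b) ≈ a * ∑ xs f when b
  ∑-*ˡ-when xs true  a f = ∑-*ˡ xs a f
  ∑-*ˡ-when xs false a f = ∑-0 xs

  ∑-filter : ∀ {A : Set} (p : A → Bool) (xs : List A) f →
    sumR (map f (filter (λ x → T? (p x)) xs)) ≈ ∑[ x ∈ xs ] (f x when p x)
  ∑-filter p []       f = ≈-refl
  ∑-filter p (x ∷ xs) f with p x
  ... | true  = +-congˡ (∑-filter p xs f)
  ... | false = ≈-trans (∑-filter p xs f) (≈-sym (+-identityˡ _))

  pow-+ : ∀ x m n → pow x (m ℕ.+ n) ≈ pow x m * pow x n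
  pow-+ x zero    n = ≈-sym (*-identityˡ _)
  pow-+ x (suc m) n = ≈-trans (*-congˡ (pow-+ x m n)) (≈-sym (*-assoc _ _ _))

  pow-+-when-∧ : ∀ z m n a b → pow z (m ℕ.+ n) when a ∧ b ≈ pow z m * (pow z n when b) when a
  pow-+-when-∧ z m n true  true  = pow-+ z m n
  pow-+-when-∧ z m n true  false = ≈-sym (zeroʳ _)
  pow-+-when-∧ z m n false b     = ≈-refl

  prod1-suc : ∀ n f → prod1 (suc n) f ≈ f 1 * prod1 n (f ∘ suc)
  prod1-suc zero    f = *-comm _ _
  prod1-suc (suc n) f = ≈-trans (*-congʳ (prod1-suc n f)) (*-assoc _ _ _)

  prod1-cong : ∀ n {f g : ℕ → Carrier} → (∀ k → f (suc k) ≈ g (suc k)) → prod1 n f ≈ prod1 n g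
  prod1-cong zero    f≈g = ≈-refl
  prod1-cong (suc n) f≈g = *-cong (prod1-cong n f≈g) (f≈g n)

  ∑-staircaseFillings-suc : ∀ n (f : Filling → Carrier) →
    ∑ (staircaseFillings (suc n)) f
    ≈ ∑[ col ∈ rowsOfLength (suc n) ] ∑[ rows ∈ staircaseFillings n ] f (prependColumn col rows)
  ∑-staircaseFillings-suc zero    f = ∑-pairs _∷_ (rowsOfLength 1) (staircaseFillings 0) f
  ∑-staircaseFillings-suc (suc n) f = begin
    ∑ (staircaseFillings (suc (suc n))) f
      ≈⟨ ∑-pairs _∷_ (rowsOfLength (suc (suc n))) (staircaseFillings (suc n)) f ⟩
    ∑[ row ∈ rowsOfLength (suc (suc n)) ] ∑[ S ∈ staircaseFillings (suc n) ] f (row ∷ S)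
      ≈⟨ ∑-pairs _∷_ allCells Rs (λ row → ∑[ S ∈ staircaseFillings (suc n) ] f (row ∷ S)) ⟩
    ∑[ c ∈ allCells ] ∑[ row ∈ Rs ] ∑[ S ∈ staircaseFillings (suc n) ] f ((c ∷ row) ∷ S)
      ≈⟨ ∑-cong allCells (λ c → ∑-cong Rs (λ row →
           ∑-staircaseFillings-suc n (λ S → f ((c ∷ row) ∷ S)))) ⟩
    ∑[ c ∈ allCells ] ∑[ row ∈ Rs ] ∑[ col ∈ Rs ] ∑[ rows ∈ Ss ] f ((c ∷ row) ∷ prependColumn col rows)
      ≈⟨ ∑-cong allCells (λ c → ∑-swap Rs Rs (λ row col →
           ∑[ rows ∈ Ss ] f ((c ∷ row) ∷ prependColumn col rows))) ⟩
    ∑[ c ∈ allCells ] ∑[ col ∈ Rs ] ∑[ row ∈ Rs ] ∑[ rows ∈ Ss ] f (prependColumn (c ∷ col) (row ∷ rows))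
      ≈⟨ ∑-cong allCells (λ c → ∑-cong Rs (λ col →
           ≈-sym (∑-pairs _∷_ Rs Ss (λ S → f (prependColumn (c ∷ col) S))))) ⟩
    ∑[ c ∈ allCells ] ∑[ col ∈ Rs ] ∑[ S ∈ staircaseFillings (suc n) ] f (prependColumn (c ∷ col) S)
      ≈⟨ ≈-sym (∑-pairs _∷_ allCells Rs (λ col →
           ∑[ S ∈ staircaseFillings (suc n) ] f (prependColumn col S))) ⟩
    ∑[ col ∈ rowsOfLength (suc (suc n)) ] ∑[ S ∈ staircaseFillings (suc n) ] f (prependColumn col S) ∎
    where
    Rs : List (List Cell)
    Rs = rowsOfLength (suc n)
    Ss : List Filling
    Ss = staircaseFillings n

  tableauSum : ℕ → Carrier → Carrier
  tableauSum n z = ∑[ S ∈ staircaseFillings n ] (pow z (r S) when isStaircaseGrid n (cell S))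

  columnSum : Bool → ℕ → Filling → Carrier → Carrier
  columnSum clear n rows z =
    ∑[ col ∈ rowsOfLength (suc n) ] (pow z (r (prependColumn col rows)) when columnFits clear n col rows)

  firstBoxSum : Carrier → (clear βδ αγ : Bool) → (Bool → Carrier) → Carrier
  firstBoxSum z clear βδ αγ rest =
    ∑[ c ∈ allCells ] (pow z (if isαγRow-∷ c αγ then 1 else 0) * rest (clear ∧ isEmpty c)
                        when (isαγ c ⇒ᵇ clear) ∧ (βδ ⇒ᵇ isEmpty c))

  columnSum-∷ : ∀ clear n row rows z → length row ≡ suc n →
    columnSum clear (suc n) (row ∷ rows) z
    ≈ firstBoxSum z clear (hasβδ row) (isαγ (leftmost row)) (λ clear′ → columnSum clear′ n rows z)
  columnSum-∷ clear n row rows z lr = begin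
    columnSum clear (suc n) (row ∷ rows) z
      ≈⟨ ∑-pairs _∷_ allCells Rs (λ col → pow z (r (prependColumn col (row ∷ rows)))
                                          when columnFits clear (suc n) col (row ∷ rows)) ⟩
    ∑[ c ∈ allCells ] ∑[ col ∈ Rs ] (pow z (r (prependColumn (c ∷ col) (row ∷ rows)))
                                      when columnFits clear (suc n) (c ∷ col) (row ∷ rows))
      ≈⟨ ∑-cong allCells (λ c → ∑-cong Rs (λ col → ≈-trans
           (reflexive (cong (pow z (r (prependColumn (c ∷ col) (row ∷ rows))) when_)
                            (columnFits-∷ clear n c col row rows lr)))
           (pow-+-when-∧ z (if isαγ (leftmost (c ∷ row)) then 1 else 0) (r (prependColumn col rows))
                         (admissible c) (columnFits (clear ∧ isEmpty c) n col rows)))) ⟩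
    ∑[ c ∈ allCells ] ∑[ col ∈ Rs ] (pow z (if isαγ (leftmost (c ∷ row)) then 1 else 0)
                                      * (pow z (r (prependColumn col rows)) when columnFits (clear ∧ isEmpty c) n col rows)
                                      when admissible c)
      ≈⟨ ∑-cong allCells (λ c → ≈-trans
           (∑-*ˡ-when Rs (admissible c) (pow z (if isαγ (leftmost (c ∷ row)) then 1 else 0)) (columnSum′ c))
           (reflexive (cong (λ αγ → pow z (if αγ then 1 else 0) * columnSum (clear ∧ isEmpty c) n rows z
                                     when admissible c)
                            (isαγ-leftmost-∷ c row)))) ⟩
    firstBoxSum z clear (hasβδ row) (isαγ (leftmost row)) (λ clear′ → columnSum clear′ n rows z) ∎
    where
    Rs : List (List Cell)
    Rs = rowsOfLength (suc n)
    admissible : Cell → Bool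
    admissible c = (isαγ c ⇒ᵇ clear) ∧ (hasβδ row ⇒ᵇ isEmpty c)
    columnSum′ : Cell → List Cell → Carrier
    columnSum′ c col = pow z (r (prependColumn col rows)) when columnFits (clear ∧ isEmpty c) n col rows

  two : Carrier
  two = fromℕ 2

  firstBoxSum-βδ : ∀ z clear rest → firstBoxSum z clear true false rest ≈ rest clear
  firstBoxSum-βδ z true  rest =
    solve 1 (λ w → con 1 :* w :+ (con 0 :+ (con 0 :+ (con 0 :+ (con 0 :+ con 0)))) := w) ≈-refl (rest true)
  firstBoxSum-βδ z false rest =
    solve 1 (λ w → con 1 :* w :+ (con 0 :+ (con 0 :+ (con 0 :+ (con 0 :+ con 0)))) := w) ≈-refl (rest false)

  firstBoxSum-blocked : ∀ z rest → firstBoxSum z false false true rest ≈ (z + two) * rest false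
  firstBoxSum-blocked z rest =
    solve 2 (λ z w → (z :* con 1) :* w :+ (con 0 :+ (con 1 :* w :+ (con 0 :+ (con 1 :* w :+ con 0))))
                     := (z :+ (con 1 :+ (con 1 :+ con 0))) :* w) ≈-refl z (rest false)

  firstBoxSum-clear : ∀ z rest → firstBoxSum z true false true rest ≈ z * rest true + (two * (z + 1#)) * rest false
  firstBoxSum-clear z rest =
    solve 3 (λ z u w → (z :* con 1) :* u :+ ((z :* con 1) :* w :+ (con 1 :* w
                         :+ ((z :* con 1) :* w :+ (con 1 :* w :+ con 0))))
                       := z :* u :+ ((con 1 :+ (con 1 :+ con 0)) :* (z :+ con 1)) :* w)
            ≈-refl z (rest true) (rest false)

  columnWeight : Bool → Carrier → Carrier
  columnWeight false z = two
  columnWeight true  z = two * (z + 1#)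

  firstBoxSum-closed : ∀ z clear βδ αγ → αγ ≡ not βδ → ∀ rest m →
    (∀ b → rest b ≈ columnWeight b z * pow (z + two) m) →
    firstBoxSum z clear βδ αγ rest ≈ columnWeight clear z * pow (z + two) ((if αγ then 1 else 0) ℕ.+ m)
  firstBoxSum-closed z clear true  false refl rest m hyp = ≈-trans (firstBoxSum-βδ z clear rest) (hyp clear)
  firstBoxSum-closed z false false true refl rest m hyp = begin
    firstBoxSum z false false true rest  ≈⟨ firstBoxSum-blocked z rest ⟩
    (z + two) * rest false               ≈⟨ *-congˡ (hyp false) ⟩
    (z + two) * (two * P)                ≈⟨ x*[y*z]≈y*[x*z] (z + two) two P ⟩
    two * ((z + two) * P)                ∎
    where P = pow (z + two) m
  firstBoxSum-closed z true  false true refl rest m hyp = begin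
    firstBoxSum z true false true rest  ≈⟨ firstBoxSum-clear z rest ⟩
    z * rest true + w * rest false      ≈⟨ +-cong (*-congˡ (hyp true)) (*-congˡ (hyp false)) ⟩
    z * (w * P) + w * (two * P)         ≈⟨ solve 4 (λ z t w P → z :* (w :* P) :+ w :* (t :* P)
                                                              := w :* ((z :+ t) :* P))
                                                   ≈-refl z two w P ⟩
    w * ((z + two) * P)                 ∎
    where
    w = two * (z + 1#)
    P = pow (z + two) m

  columnSum-closed : ∀ clear n rows z → StaircaseShape n rows → All αγ⇔¬βδ rows →
    columnSum clear n rows z ≈ columnWeight clear z * pow (z + two) (r rows)
  columnSum-closed false zero [] z [] [] =
    solve 0 (con 0 :+ (con 0 :+ (con 1 :+ (con 0 :+ (con 1 :+ con 0)))) := (con 1 :+ (con 1 :+ con 0)) :* con 1) ≈-refl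
  columnSum-closed true  zero [] z [] [] =
    solve 1 (λ z → con 0 :+ ((z :* con 1) :+ (con 1 :+ ((z :* con 1) :+ (con 1 :+ con 0))))
                   := ((con 1 :+ (con 1 :+ con 0)) :* (z :+ con 1)) :* con 1) ≈-refl z
  columnSum-closed clear (suc n) (row ∷ rows) z (lr ∷ sh) (g ∷ gs) =
    ≈-trans (columnSum-∷ clear n row rows z lr)
            (firstBoxSum-closed z clear (hasβδ row) (isαγ (leftmost row)) g _ (r rows)
                                (λ b → columnSum-closed b n rows z sh gs))

  columnSum-when-tableau : ∀ n rows z → StaircaseShape n rows →
    ∑[ col ∈ rowsOfLength (suc n) ] (pow z (r (prependColumn col rows))
                                      when isStaircaseGrid n (cell rows) ∧ columnFits true n col rows)
    ≈ two * (z + 1#) * (pow (z + two) (r rows) when isStaircaseGrid n (cell rows))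
  columnSum-when-tableau n rows z sh with isStaircaseGrid n (cell rows) in valid
  ... | true  = columnSum-closed true n rows z sh (isStaircaseGrid⇒αγ⇔¬βδ n rows sh valid)
  ... | false = ≈-trans (∑-0 (rowsOfLength (suc n))) (≈-sym (zeroʳ _))

  tableauSum-suc : ∀ n z → tableauSum (suc n) z ≈ two * (z + 1#) * tableauSum n (z + two)
  tableauSum-suc n z = begin
    tableauSum (suc n) z
      ≈⟨ ∑-staircaseFillings-suc n (λ S → pow z (r S) when isStaircaseGrid (suc n) (cell S)) ⟩
    ∑[ col ∈ Rs ] ∑[ rows ∈ Ss ] (pow z (r (prependColumn col rows))
                                  when isStaircaseGrid (suc n) (cell (prependColumn col rows)))
      ≈⟨ ∑-cong Rs (λ col → ∑-cong Ss (λ rows →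
           reflexive (cong (pow z (r (prependColumn col rows)) when_) (isStaircaseGrid-prependColumn n col rows)))) ⟩
    ∑[ col ∈ Rs ] ∑[ rows ∈ Ss ] (pow z (r (prependColumn col rows))
                                  when isStaircaseGrid n (cell rows) ∧ columnFits true n col rows)
      ≈⟨ ∑-swap Rs Ss (λ col rows → pow z (r (prependColumn col rows))
                                     when isStaircaseGrid n (cell rows) ∧ columnFits true n col rows) ⟩
    ∑[ rows ∈ Ss ] ∑[ col ∈ Rs ] (pow z (r (prependColumn col rows))
                                  when isStaircaseGrid n (cell rows) ∧ columnFits true n col rows)
      ≈⟨ ∑-cong-All (staircaseFillings-shape n) (λ {rows} sh → columnSum-when-tableau n rows z sh) ⟩
    ∑[ rows ∈ Ss ] (two * (z + 1#) * (pow (z + two) (r rows) when isStaircaseGrid n (cell rows)))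
      ≈⟨ ∑-*ˡ Ss (two * (z + 1#)) (λ rows → pow (z + two) (r rows) when isStaircaseGrid n (cell rows)) ⟩
    two * (z + 1#) * tableauSum n (z + two) ∎
    where
    Rs : List (List Cell)
    Rs = rowsOfLength (suc n)
    Ss : List Filling
    Ss = staircaseFillings n

  odd : Carrier → ℕ → Carrier
  odd z k = z + fromℕ (2 ℕ.* k ∸ 1)

  odd-shift : ∀ z k → odd z (suc (suc k)) ≈ odd (z + two) (suc k)
  odd-shift z k = begin
    z + fromℕ (2 ℕ.* suc (suc k) ∸ 1)     ≡⟨ cong (λ m → z + fromℕ m) (2[2+k]∸1 k) ⟩
    z + fromℕ (suc (suc (2 ℕ.* suc k ∸ 1))) ≈⟨ solve 2 (λ z x → z :+ (con 1 :+ (con 1 :+ x))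
                                                       := (z :+ (con 1 :+ (con 1 :+ con 0))) :+ x)
                                                  ≈-refl z (fromℕ (2 ℕ.* suc k ∸ 1)) ⟩
    (z + two) + fromℕ (2 ℕ.* suc k ∸ 1)     ∎

  tableauSum-closed : ∀ n z → tableauSum n z ≈ pow two n * prod1 n (odd z)
  tableauSum-closed zero    z = solve 0 (con 1 :+ con 0 := con 1 :* con 1) ≈-refl
  tableauSum-closed (suc n) z = begin
    tableauSum (suc n) z
      ≈⟨ tableauSum-suc n z ⟩
    two * (z + 1#) * tableauSum n (z + two)
      ≈⟨ *-congˡ (tableauSum-closed n (z + two)) ⟩
    two * (z + 1#) * (pow two n * prod1 n (odd (z + two)))
      ≈⟨ *-congˡ (*-congˡ (≈-sym (prod1-cong n (odd-shift z)))) ⟩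
    two * (z + 1#) * (pow two n * prod1 n (odd z ∘ suc))
      ≈⟨ solve 4 (λ z t Q P → (t :* (z :+ con 1)) :* (Q :* P) := (t :* Q) :* ((z :+ (con 1 :+ con 0)) :* P))
                 ≈-refl z two (pow two n) (prod1 n (odd z ∘ suc)) ⟩
    pow two (suc n) * (odd z 1 * prod1 n (odd z ∘ suc))
      ≈⟨ *-congˡ (≈-sym (prod1-suc n (odd z))) ⟩
    pow two (suc n) * prod1 (suc n) (odd z) ∎

-- The identity also holds for n = 0 (both sides are 1).
proposition4 : ∀ {c ℓ} (R : CommutativeRing c ℓ) (n : ℕ) → 1 ≤ n →
    let open CommutativeRing R in let open RingOps R in
    ∀ (z : Carrier) →
      sumR (map (λ S → pow z (r S)) (𝒮 n))
        ≈ pow (fromℕ 2) n * prod1 n (λ k → z + fromℕ (2 ℕ.* k ∸ 1))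
proposition4 R n _ z = begin
  sumR (map (λ S → pow z (r S)) (𝒮 n))
    ≈⟨ ∑-filter (isStaircaseTableau n) (staircaseFillings n) (λ S → pow z (r S)) ⟩
  ∑[ S ∈ staircaseFillings n ] (pow z (r S) when isStaircaseTableau n S)
    ≈⟨ ∑-cong (staircaseFillings n) (λ S →
         reflexive (cong (pow z (r S) when_) (isStaircaseTableau≡isStaircaseGrid n S))) ⟩
  tableauSum n z
    ≈⟨ tableauSum-closed n z ⟩
  pow two n * prod1 n (odd z) ∎
  where
  open CommutativeRing R
  open RingOps R
  open GeneratingFunction R
  open import Relation.Binary.Reasoning.Setoid setoid
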